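{- For every integer $n\ge 0$, $g(T_n)=n$.
   Context: A decoration of a graph is a set of arrows on edges, at most one per edge; a vertex is a sink (source) if all its edges carry arrows into (out of) it; a state is a decoration with no sink or source at a vertex of degree $\ge2$. A follower of a state $X$ is a state $X\cup\{(v,w)\}$ with $\{v,w\}$ unmarked in $X$. Grundy value: $g(X)=\mathrm{mex}\{g(Y): Y \text{ a follower of } X\}$. For $n\ge0$, $T_n$ is the state $\{(n,n+1)\}$ of the path with vertices $0,1,\dots,n+1$ (consecutive integers adjacent). -}

module Defs where

open import Data.Nat using (ℕ; zero; suc; _+_; _≤ᵇ_)
open import Data.Nat.Properties using () renaming (_≟_ to _≟ℕ_)
open import Data.Bool using (Bool; true; false; _∧_; _∨_; not; if_then_else_)
open import Data.Fin using (Fin; inject₁) renaming (suc to fsuc)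
open import Data.Fin.Properties using () renaming (_≟_ to _≟F_)
open import Data.Product using (_×_; _,_; proj₁; proj₂)
open import Data.Bool.ListAction using (all; any)
open import Data.List using (List; []; _∷_; allFin; length; filter; concatMap; map; upTo; filterᵇ)
open import Relation.Nullary using (does)

record Graph : Set where
  field
    V : ℕ
    E : ℕ
    ends : Fin E → Fin V × Fin V
open Graph public

-- Mark on an edge with ends (a , b):
--   none : unmarked;  fwd : arrow (a , b);  bwd : arrow (b , a).
-- A decoration (set of arrows, at most one per edge) is a function on edges.
data Mark : Set where
  none fwd bwd : Mark

Decoration : Graph → Set
Decoration G = Fin (E G) → Mark

module _ (G : Graph) where
  _=F_ : Fin (V G) → Fin (V G) → Bool
  a =F b = does (a ≟F b)

  incident : Fin (V G) → List (Fin (E G))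
  incident v = filterᵇ (λ e → (proj₁ (ends G e) =F v) ∨ (proj₂ (ends G e) =F v)) (allFin (E G))

  degree : Fin (V G) → ℕ
  degree v = length (incident v)

  into : Decoration G → Fin (V G) → Fin (E G) → Bool
  into X v e with X e
  ... | none = false
  ... | fwd  = proj₂ (ends G e) =F v
  ... | bwd  = proj₁ (ends G e) =F v

  outOf : Decoration G → Fin (V G) → Fin (E G) → Bool
  outOf X v e with X e
  ... | none = false
  ... | fwd  = proj₁ (ends G e) =F v
  ... | bwd  = proj₂ (ends G e) =F v

  isSink isSource : Decoration G → Fin (V G) → Bool
  isSink X v = all (into X v) (incident v)
  isSource X v = all (outOf X v) (incident v)

  isState : Decoration G → Bool
  isState X = all (λ v → not ((2 ≤ᵇ degree v) ∧ (isSink X v ∨ isSource X v))) (allFin (V G))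

  update : Decoration G → Fin (E G) → Mark → Decoration G
  update X e d e' = if does (e' ≟F e) then d else X e'

  isNone : Mark → Bool
  isNone none = true
  isNone _ = false

  followers : Decoration G → List (Decoration G)
  followers X =
    filterᵇ isState
      (concatMap (λ e → if isNone (X e) then update X e fwd ∷ update X e bwd ∷ [] else [])
                 (allFin (E G)))

_∈ᵇ_ : ℕ → List ℕ → Bool
k ∈ᵇ l = any (λ m → does (k ≟ℕ m)) l

mexFrom : List ℕ → List ℕ → ℕ
mexFrom [] l = 0
mexFrom (k ∷ ks) l = if k ∈ᵇ l then mexFrom ks l else k

mex : List ℕ → ℕ
mex l = mexFrom (upTo (suc (length l))) l

module _ (G : Graph) where
  -- Grundy value with fuel; each move marks one more edge, so fuel E G suffices
  -- (after E G moves no unmarked edge remains, so there are no followers).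
  grundyFuel : ℕ → Decoration G → ℕ
  grundyFuel zero X = 0
  grundyFuel (suc k) X = mex (map (grundyFuel k) (followers G X))

  grundy : Decoration G → ℕ
  grundy X = grundyFuel (E G) X

Path : ℕ → Graph
Path n = record { V = suc (suc n) ; E = suc n ; ends = λ i → inject₁ i , fsuc i }

-- T_n = {(n , n+1)}: the last edge (index n) carries the arrow n → n+1.
lastEdge : (n : ℕ) → Fin (suc n)
lastEdge zero = Data.Fin.zero
lastEdge (suc n) = fsuc (lastEdge n)

T : (n : ℕ) → Decoration (Path n)
T n e = if does (e ≟F lastEdge n) then fwd else none

-- A decoration of the path whose last edge carries the arrow n → n+1 is a state iff no two
-- adjacent arrows point in opposite directions. Reading the path from vertex 0, such a position
-- is summarised by a, the number of unmarked edges before the first arrow, u, the number of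
-- unmarked edges behind it, and whether that arrow points back towards vertex 0 (b); its
-- Grundy value is the nim-sum a ⊕ ε with ε = (u mod 2) xor b. Marking an edge in front of the
-- first arrow acts like a Nim heap of size a (the edge adjacent to the arrow must copy its
-- direction, which keeps ε), while marking an edge behind it flips ε; such a move exists
-- whenever ε = 1, because the unmarked edges behind the first arrow can only all be blocked if
-- the arrows change direction across each of them and end with a forward arrow. T_n has a = n,
-- u = 0 and b false.
module Submission where

open import Defs
open import Data.Bool using (Bool; true; false; not; _∧_; _∨_; _xor_; if_then_else_) renaming (T to True)
open import Data.Bool.ListAction using (all; and)
open import Data.Bool.Properties
  using (T-≡; ∧-conicalˡ; ∧-conicalʳ; ¬-not; not-involutive; not-distribˡ-xor; not-distribʳ-xor; xor-assoc; xor-same)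
  renaming (_≟_ to _≟ᵇ_)
open import Data.Empty using (⊥-elim)
open import Data.Fin using (Fin) renaming (zero to fzero; suc to fsuc)
open import Data.Fin.Properties using (pigeonhole; toℕ<n) renaming (_≟_ to _≟F_)
open import Data.List using (List; []; _∷_; map; lookup; length; applyUpTo; allFin; concatMap; filterᵇ; tabulate)
open import Data.List.Properties using (filter-none; length-map; map-∘; map-cong; map-tabulate; tabulate-cong)
open import Data.List.Relation.Unary.All.Properties using (tabulate⁺)
open import Data.List.Membership.Propositional using (_∈_; _∉_)
open import Data.List.Membership.Propositional.Properties
  using (∈-map⁺; ∈-map⁻; ∈-filter⁻; ∈-filter⁺; ∈-concatMap⁻; ∈-concatMap⁺; ∈-allFin)
open import Data.List.Relation.Unary.Any as Any using (Any; here; there)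
open import Data.List.Relation.Unary.Any.Properties using (any⁺; any⁻; lookup-index)
open import Data.Nat using (ℕ; zero; suc; _+_; _<_; _≤_; _≤?_; _<?_; _≤ᵇ_; ⌊_/2⌋; s≤s; z≤n; z<s; s<s)
open import Data.Nat.Properties
  using (≡ᵇ⇒≡; ≡⇒≡ᵇ; ≰⇒>; <⇒≢; ≤⇒≯; ≮⇒≥; ≤-refl; ≤-reflexive; ≤-trans; ≤-antisym; ≤-pred; n≤1+n; n<1+n;
         suc-injective; <-cmp; +-suc; n≤0⇒n≡0; ⌊n/2⌋-mono)
open import Data.Vec.Functional using (head; tail)
open import Data.Product using (Σ; _×_; _,_; ∃₂; proj₁; proj₂)
open import Data.Sum as Sum using (_⊎_; inj₁; inj₂)
open import Function using (_∘_; id; Equivalence)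
open import Relation.Binary using (tri<; tri≈; tri>)
open import Relation.Binary.PropositionalEquality
  using (_≡_; _≢_; _≗_; refl; sym; trans; cong; cong₂; subst; module ≡-Reasoning)
open import Relation.Nullary using (does; yes; no; contradiction)
open import Relation.Nullary.Decidable using (T?)

∈ᵇ⇒∈ : ∀ {k} l → True (k ∈ᵇ l) → k ∈ l
∈ᵇ⇒∈ {k} l = Any.map (≡ᵇ⇒≡ k _) ∘ any⁻ _ l

∈⇒∈ᵇ : ∀ {k l} → k ∈ l → True (k ∈ᵇ l)
∈⇒∈ᵇ {k} = any⁺ _ ∘ Any.map (≡⇒≡ᵇ k _)

range⊆⇒≤-length : ∀ v (l : List ℕ) → (∀ {w} → w < v → w ∈ l) → v ≤ length l
range⊆⇒≤-length v l below with v ≤? length l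
... | yes v≤ = v≤
... | no v≰ =
  let i , j , i<j , same = pigeonhole (≰⇒> v≰) position
  in contradiction (trans (lookup-index (below (toℕ<n i)))
       (trans (cong (lookup l) same) (sym (lookup-index (below (toℕ<n j)))))) (<⇒≢ i<j)
  where
  position : Fin v → Fin (length l)
  position i = Any.index (below (toℕ<n i))

mexFrom-applyUpTo : ∀ (f : ℕ → ℕ) l {m v} → v < m → (∀ {w} → w < v → f w ∈ l) → f v ∉ l →
                    mexFrom (applyUpTo f m) l ≡ f v
mexFrom-applyUpTo f l {suc m} {zero} _ _ fv∉l with f 0 ∈ᵇ l in eq
... | true = contradiction (∈ᵇ⇒∈ l (subst True (sym eq) _)) fv∉l
... | false = refl
mexFrom-applyUpTo f l {suc m} {suc v} (s<s v<m) below fv∉l with f 0 ∈ᵇ l in eq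
... | true = mexFrom-applyUpTo (f ∘ suc) l v<m (below ∘ s<s) fv∉l
... | false = ⊥-elim (subst True eq (∈⇒∈ᵇ (below z<s)))

mex≡ : ∀ l {v} → (∀ {w} → w < v → w ∈ l) → v ∉ l → mex l ≡ v
mex≡ l below v∉l = mexFrom-applyUpTo id l (s≤s (range⊆⇒≤-length _ l below)) below v∉l

arrow : Bool → Mark
arrow false = fwd
arrow true = bwd

module _ (G : Graph) (X : Decoration G) where

  private
    extensions : Fin (E G) → List (Decoration G)
    extensions e = if isNone G (X e) then update G X e fwd ∷ update G X e bwd ∷ [] else []

  ∈-followers⁻ : ∀ {Y} → Y ∈ followers G X →
                 ∃₂ λ e c → X e ≡ none × Y ≡ update G X e (arrow c) × isState G Y ≡ true
  ∈-followers⁻ {Y} Y∈ with ∈-filter⁻ (T? ∘ isState G) {xs = concatMap extensions (allFin (E G))} Y∈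
  ... | Y∈ext , stateY with Any.satisfied (∈-concatMap⁻ extensions {xs = allFin (E G)} Y∈ext)
  ... | e , Y∈e with X e in eq
  ...   | none = e , fromExtension Y∈e
    where
    fromExtension : Y ∈ update G X e fwd ∷ update G X e bwd ∷ [] →
                    Σ Bool λ c → X e ≡ none × Y ≡ update G X e (arrow c) × isState G Y ≡ true
    fromExtension (here refl) = false , eq , refl , Equivalence.to T-≡ stateY
    fromExtension (there (here refl)) = true , eq , refl , Equivalence.to T-≡ stateY
  ∈-followers⁻ _ | _ | e , () | fwd
  ∈-followers⁻ _ | _ | e , () | bwd

  ∈-followers⁺ : ∀ e c → X e ≡ none → isState G (update G X e (arrow c)) ≡ true →
                 update G X e (arrow c) ∈ followers G X
  ∈-followers⁺ e c Xe≡none state =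
    ∈-filter⁺ (T? ∘ isState G)
              (∈-concatMap⁺ extensions (Any.map (λ { refl → ∈-extensions c }) (∈-allFin e)))
              (Equivalence.from T-≡ state)
    where
    ∈-extensions : ∀ c → update G X e (arrow c) ∈ extensions e
    ∈-extensions c rewrite Xe≡none with c
    ... | false = here refl
    ... | true = there (here refl)

filterᵇ-map : ∀ {A B : Set} (p : B → Bool) (f : A → B) xs →
              filterᵇ p (map f xs) ≡ map f (filterᵇ (p ∘ f) xs)
filterᵇ-map p f [] = refl
filterᵇ-map p f (x ∷ xs) with p (f x)
... | true = cong (f x ∷_) (filterᵇ-map p f xs)
... | false = filterᵇ-map p f xs

all-map : ∀ {A B : Set} (p : B → Bool) (f : A → B) xs → all p (map f xs) ≡ all (p ∘ f) xs
all-map p f xs = cong and (sym (map-∘ xs))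

all-cong : ∀ {A : Set} {p q : A → Bool} → p ≗ q → all p ≗ all q
all-cong p≗q xs = cong and (map-cong p≗q xs)

compatible : Mark → Mark → Bool
compatible fwd bwd = false
compatible bwd fwd = false
compatible _ _ = true

pathState : ∀ n → Decoration (Path n) → Bool
pathState zero X = true
pathState (suc n) X = compatible (head X) (head (tail X)) ∧ pathState n (tail X)

private
  endsAt : ∀ n → Fin (suc (suc n)) → Fin (suc n) → Bool
  endsAt n v e = does (proj₁ (ends (Path n) e) ≟F v) ∨ does (proj₂ (ends (Path n) e) ≟F v)

incident-Path-zero : ∀ n → incident (Path n) fzero ≡ fzero ∷ []
incident-Path-zero n =
  cong (fzero ∷_) (filter-none (T? ∘ endsAt n fzero) {xs = tabulate fsuc} (tabulate⁺ (λ _ ())))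

incident-Path-one : ∀ n → incident (Path (suc n)) (fsuc fzero) ≡ fzero ∷ fsuc fzero ∷ []
incident-Path-one n =
  cong (λ es → fzero ∷ fsuc fzero ∷ es)
       (filter-none (T? ∘ endsAt (suc n) (fsuc fzero)) {xs = tabulate (fsuc ∘ fsuc)} (tabulate⁺ (λ _ ())))

incident-Path-suc : ∀ n w → incident (Path (suc n)) (fsuc (fsuc w)) ≡ map fsuc (incident (Path n) (fsuc w))
incident-Path-suc n w =
  trans (cong (filterᵇ (endsAt (suc n) (fsuc (fsuc w)))) (sym (map-tabulate id fsuc)))
        (filterᵇ-map (endsAt (suc n) (fsuc (fsuc w))) fsuc (allFin (suc n)))

into-tail : ∀ n X v i → into (Path (suc n)) X (fsuc v) (fsuc i) ≡ into (Path n) (tail X) v i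
into-tail n X v i with X (fsuc i)
... | none = refl
... | fwd = refl
... | bwd = refl

outOf-tail : ∀ n X v i → outOf (Path (suc n)) X (fsuc v) (fsuc i) ≡ outOf (Path n) (tail X) v i
outOf-tail n X v i with X (fsuc i)
... | none = refl
... | fwd = refl
... | bwd = refl

private
  neither : ∀ {A : Set} → List A → (A → Bool) → (A → Bool) → Bool
  neither es p q = not ((2 ≤ᵇ length es) ∧ (all p es ∨ all q es))

  neither-map : ∀ {A B : Set} (f : A → B) es {p q p′ q′} → p ∘ f ≗ p′ → q ∘ f ≗ q′ →
                neither (map f es) p q ≡ neither es p′ q′
  neither-map f es {p} {q} p≗ q≗ =
    cong₂ (λ d s → not ((2 ≤ᵇ d) ∧ s)) (length-map f es)
          (cong₂ _∨_ (trans (all-map p f es) (all-cong p≗ es)) (trans (all-map q f es) (all-cong q≗ es)))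

  admissibleOn : ∀ n → Decoration (Path n) → Fin (suc (suc n)) → List (Fin (suc n)) → Bool
  admissibleOn n X v es = neither es (into (Path n) X v) (outOf (Path n) X v)

admissibleAt : ∀ n → Decoration (Path n) → Fin (suc (suc n)) → Bool
admissibleAt n X v = admissibleOn n X v (incident (Path n) v)

admissibleAt-zero : ∀ n X → admissibleAt n X fzero ≡ true
admissibleAt-zero n X = cong (admissibleOn n X fzero) (incident-Path-zero n)

admissibleAt-one : ∀ n X → admissibleAt (suc n) X (fsuc fzero) ≡ compatible (X fzero) (X (fsuc fzero))
admissibleAt-one n X = trans (cong (admissibleOn (suc n) X (fsuc fzero)) (incident-Path-one n)) twoEdges
  where
  twoEdges : admissibleOn (suc n) X (fsuc fzero) (fzero ∷ fsuc fzero ∷ []) ≡ compatible (X fzero) (X (fsuc fzero))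
  twoEdges with X fzero | X (fsuc fzero)
  ... | none | _ = refl
  ... | fwd | none = refl
  ... | fwd | fwd = refl
  ... | fwd | bwd = refl
  ... | bwd | none = refl
  ... | bwd | fwd = refl
  ... | bwd | bwd = refl

admissibleAt-suc : ∀ n X w → admissibleAt (suc n) X (fsuc (fsuc w)) ≡ admissibleAt n (tail X) (fsuc w)
admissibleAt-suc n X w = trans (cong (admissibleOn (suc n) X (fsuc (fsuc w))) (incident-Path-suc n w))
  (neither-map fsuc (incident (Path n) (fsuc w)) (into-tail n X (fsuc w)) (outOf-tail n X (fsuc w)))

isState-Path : ∀ n X → isState (Path n) X ≡ pathState n X
isState-Path zero X = refl
isState-Path (suc n) X = begin
  admissibleAt (suc n) X fzero ∧ (admissibleAt (suc n) X (fsuc fzero) ∧ all (admissibleAt (suc n) X) inner)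
    ≡⟨ cong₂ (λ a b → a ∧ (b ∧ all (admissibleAt (suc n) X) inner))
             (admissibleAt-zero (suc n) X) (admissibleAt-one n X) ⟩
  compatible (head X) (head (tail X)) ∧ all (admissibleAt (suc n) X) inner
    ≡⟨ cong (λ b → compatible (head X) (head (tail X)) ∧ and b) shift ⟩
  compatible (head X) (head (tail X)) ∧ all (admissibleAt n (tail X)) (tabulate fsuc)
    ≡⟨ cong (λ a → compatible (head X) (head (tail X)) ∧ (a ∧ all (admissibleAt n (tail X)) (tabulate fsuc)))
            (sym (admissibleAt-zero n (tail X))) ⟩
  compatible (head X) (head (tail X)) ∧ isState (Path n) (tail X)
    ≡⟨ cong (compatible (head X) (head (tail X)) ∧_) (isState-Path n (tail X)) ⟩
  pathState (suc n) X ∎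
  where
  open ≡-Reasoning
  inner : List (Fin (suc (suc (suc n))))
  inner = tabulate (fsuc ∘ fsuc)
  shift : map (admissibleAt (suc n) X) inner ≡ map (admissibleAt n (tail X)) (tabulate fsuc)
  shift = trans (map-tabulate (fsuc ∘ fsuc) (admissibleAt (suc n) X))
            (trans (tabulate-cong (admissibleAt-suc n X)) (sym (map-tabulate fsuc (admissibleAt n (tail X)))))

flipLowBit : ℕ → ℕ
flipLowBit zero = 1
flipLowBit (suc zero) = 0
flipLowBit (suc (suc x)) = suc (suc (flipLowBit x))

-- x ⊕ ε is the nim-sum of x with ε read as 0 or 1.
infixl 6 _⊕_
_⊕_ : ℕ → Bool → ℕ
x ⊕ false = x
x ⊕ true = flipLowBit x

flipLowBit-involutive : ∀ x → flipLowBit (flipLowBit x) ≡ x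
flipLowBit-involutive zero = refl
flipLowBit-involutive (suc zero) = refl
flipLowBit-involutive (suc (suc x)) = cong (suc ∘ suc) (flipLowBit-involutive x)

flipLowBit-≢ : ∀ x → flipLowBit x ≢ x
flipLowBit-≢ (suc (suc x)) eq = flipLowBit-≢ x (suc-injective (suc-injective eq))

⌊flipLowBit/2⌋ : ∀ x → ⌊ flipLowBit x /2⌋ ≡ ⌊ x /2⌋
⌊flipLowBit/2⌋ zero = refl
⌊flipLowBit/2⌋ (suc zero) = refl
⌊flipLowBit/2⌋ (suc (suc x)) = cong suc (⌊flipLowBit/2⌋ x)

flipLowBit-suc : ∀ x → flipLowBit (suc x) ≡ x ⊎ suc (flipLowBit x) ≡ x
flipLowBit-suc zero = inj₁ refl
flipLowBit-suc (suc zero) = inj₂ refl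
flipLowBit-suc (suc (suc x)) = Sum.map (cong (suc ∘ suc)) (cong (suc ∘ suc)) (flipLowBit-suc x)

⊕-injectiveˡ : ∀ {x y} ε → x ⊕ ε ≡ y ⊕ ε → x ≡ y
⊕-injectiveˡ false eq = eq
⊕-injectiveˡ {x} {y} true eq =
  trans (sym (flipLowBit-involutive x)) (trans (cong flipLowBit eq) (flipLowBit-involutive y))

⊕-not : ∀ x ε → x ⊕ not ε ≢ x ⊕ ε
⊕-not x false = flipLowBit-≢ x
⊕-not x true = flipLowBit-≢ x ∘ sym

⌊⊕/2⌋ : ∀ x ε → ⌊ x ⊕ ε /2⌋ ≡ ⌊ x /2⌋
⌊⊕/2⌋ x false = refl
⌊⊕/2⌋ x true = ⌊flipLowBit/2⌋ x

⊕-≤ : ∀ x ε → x ⊕ ε ≤ suc x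
⊕-≤ x false = n≤1+n x
⊕-≤ zero true = ≤-refl
⊕-≤ (suc zero) true = z≤n
⊕-≤ (suc (suc x)) true = s≤s (s≤s (⊕-≤ x true))

data Below (x : ℕ) (ε : Bool) (w : ℕ) : Set where
  cut : ∀ k δ → 2 + k ≤ x → k ⊕ δ ≡ w → Below x ε w
  shrink : suc w ≡ x → ε ≡ false → Below x ε w
  turn : w ≡ x → ε ≡ true → Below x ε w

below : ∀ x ε {w} → w < x ⊕ ε → Below x ε w
below x ε {w} w< with <-cmp (suc w) x
... | tri< sw<x _ _ = cut w false sw<x refl
below x false w< | tri≈ _ refl _ = shrink refl refl
below x true {w} w< | tri≈ _ refl _ with flipLowBit-suc w
... | inj₁ eq = contradiction eq (<⇒≢ w< ∘ sym)
... | inj₂ eq = cut (flipLowBit w) true (≤-reflexive (cong suc eq)) (flipLowBit-involutive w)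
below x false w< | tri> _ _ x<sw = contradiction w< (≤⇒≯ (≤-pred x<sw))
below x true w< | tri> _ _ x<sw = turn (≤-antisym (≤-pred (≤-trans w< (⊕-≤ x true))) (≤-pred x<sw)) refl

unmarked : Mark → ℕ
unmarked none = 1
unmarked _ = 0

unmarkedCount : ∀ n → Decoration (Path n) → ℕ
unmarkedCount zero X = unmarked (head X)
unmarkedCount (suc n) X = unmarked (head X) + unmarkedCount n (tail X)

parity : ℕ → Bool
parity zero = false
parity (suc n) = not (parity n)

-- Reading the path from vertex 0: lead unmarked edges, then the first arrow (pointing
-- towards vertex 0 iff firstBwd), and later unmarked edges behind it.
record Profile : Set where
  constructor ⟨_,_,_⟩
  field
    lead : ℕ
    later : ℕ
    firstBwd : Bool
open Profile

parityBit : Profile → Bool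
parityBit p = parity (later p) xor firstBwd p

value : Profile → ℕ
value p = lead p ⊕ parityBit p

extendLead : Profile → Profile
extendLead p = record p { lead = suc (lead p) }

profileCons : Mark → Profile → ℕ → Profile
profileCons none p u = extendLead p
profileCons fwd p u = ⟨ 0 , u , false ⟩
profileCons bwd p u = ⟨ 0 , u , true ⟩

profile : ∀ n → Decoration (Path n) → Profile
profile zero X = profileCons (head X) ⟨ 0 , 0 , false ⟩ 0
profile (suc n) X = profileCons (head X) (profile n (tail X)) (unmarkedCount n (tail X))

unmarked-arrow : ∀ c → unmarked (arrow c) ≡ 0
unmarked-arrow false = refl
unmarked-arrow true = refl

profileCons-arrow : ∀ c p u → profileCons (arrow c) p u ≡ ⟨ 0 , u , c ⟩
profileCons-arrow false p u = refl
profileCons-arrow true p u = refl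

profile-arrow : ∀ n (X : Decoration (Path n)) {c} → head X ≡ arrow c →
                profile n X ≡ ⟨ 0 , unmarkedCount n X , c ⟩
profile-arrow zero X {false} eq rewrite eq = refl
profile-arrow zero X {true} eq rewrite eq = refl
profile-arrow (suc n) X {false} eq rewrite eq = refl
profile-arrow (suc n) X {true} eq rewrite eq = refl

unmarkedCount-none : ∀ n (X : Decoration (Path (suc n))) → head X ≡ none →
                     unmarkedCount (suc n) X ≡ suc (unmarkedCount n (tail X))
unmarkedCount-none n X free = cong (λ m → unmarked m + unmarkedCount n (tail X)) free

unmarkedCount-arrow : ∀ n (X : Decoration (Path (suc n))) {c} → head X ≡ arrow c →
                      unmarkedCount (suc n) X ≡ unmarkedCount n (tail X)
unmarkedCount-arrow n X {c} marked =
  cong (_+ unmarkedCount n (tail X)) (trans (cong unmarked marked) (unmarked-arrow c))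

head-none⇒lead-pos : ∀ n (X : Decoration (Path n)) → head X ≡ none → 1 ≤ lead (profile n X)
head-none⇒lead-pos zero X eq rewrite eq = ≤-refl
head-none⇒lead-pos (suc n) X eq rewrite eq = s≤s z≤n

profile-none : ∀ n (X : Decoration (Path (suc n))) → head X ≡ none →
               profile (suc n) X ≡ extendLead (profile n (tail X))
profile-none n X free = cong (λ m → profileCons m (profile n (tail X)) (unmarkedCount n (tail X))) free

lead-pos⇒head-none : ∀ n (X : Decoration (Path n)) → 1 ≤ lead (profile n X) → head X ≡ none
lead-pos⇒head-none zero X le with X fzero
... | none = refl
lead-pos⇒head-none (suc n) X le with X fzero
... | none = refl

compatible-refl : ∀ {m m′} → m ≡ m′ → compatible m m′ ≡ true
compatible-refl {none} refl = refl
compatible-refl {fwd} refl = refl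
compatible-refl {bwd} refl = refl

compatible-noneˡ : ∀ {m} m′ → m ≡ none → compatible m m′ ≡ true
compatible-noneˡ m′ refl = refl

compatible-noneʳ : ∀ m {m′} → m′ ≡ none → compatible m m′ ≡ true
compatible-noneʳ none refl = refl
compatible-noneʳ fwd refl = refl
compatible-noneʳ bwd refl = refl

markView : ∀ m → m ≡ none ⊎ Σ Bool λ c → m ≡ arrow c
markView none = inj₁ refl
markView fwd = inj₂ (false , refl)
markView bwd = inj₂ (true , refl)

compatible-arrow : ∀ {c c′} → compatible (arrow c) (arrow c′) ≡ true → c ≡ c′
compatible-arrow {false} {false} _ = refl
compatible-arrow {true} {true} _ = refl

profile-arrow-suc : ∀ n (X : Decoration (Path (suc n))) {c} → head X ≡ arrow c →
                    profile (suc n) X ≡ ⟨ 0 , unmarkedCount n (tail X) , c ⟩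
profile-arrow-suc n X {c} marked =
  trans (profile-arrow (suc n) X marked) (cong (λ k → ⟨ 0 , k , c ⟩) (unmarkedCount-arrow n X marked))

play : ∀ {n} → Decoration (Path n) → Fin (suc n) → Bool → Decoration (Path n)
play {n} X e c = update (Path n) X e (arrow c)

record Move (n : ℕ) (X : Decoration (Path n)) : Set where
  constructor move
  field
    edge : Fin (suc n)
    dir : Bool
    free : X edge ≡ none
    legal : pathState n (play X edge dir) ≡ true

after : ∀ {n X} → Move n X → Decoration (Path n)
after {X = X} (move e c _ _) = play X e c

liftMove : ∀ {n} {X : Decoration (Path (suc n))} (mv : Move n (tail X)) →
           compatible (head X) (head (after mv)) ≡ true → Move (suc n) X
liftMove (move e c free legal) ok = move (fsuc e) c free (cong₂ _∧_ ok legal)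

unmarkedCount-play : ∀ n (X : Decoration (Path n)) {e} c → X e ≡ none →
                     suc (unmarkedCount n (play X e c)) ≡ unmarkedCount n X
unmarkedCount-play zero X {fzero} c free rewrite free | unmarked-arrow c = refl
unmarkedCount-play (suc n) X {fzero} c free rewrite free | unmarked-arrow c = refl
unmarkedCount-play (suc n) X {fsuc e} c free =
  trans (sym (+-suc (unmarked (head X)) _)) (cong (unmarked (head X) +_) (unmarkedCount-play n (tail X) c free))

unmarkedCount-after : ∀ n {X : Decoration (Path n)} (mv : Move n X) →
                      suc (unmarkedCount n (after mv)) ≡ unmarkedCount n X
unmarkedCount-after n {X} (move e c free _) = unmarkedCount-play n X c free

parity-after : ∀ n {X : Decoration (Path n)} (mv : Move n X) →
               parity (unmarkedCount n (after mv)) ≡ not (parity (unmarkedCount n X))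
parity-after n mv = trans (sym (not-involutive _)) (cong (not ∘ parity) (unmarkedCount-after n mv))

lastEdge-after : ∀ n {X : Decoration (Path n)} (mv : Move n X) →
                 X (lastEdge n) ≡ fwd → after mv (lastEdge n) ≡ fwd
lastEdge-after n (move e c free _) lastFwd with lastEdge n ≟F e
... | yes refl = contradiction (trans (sym free) lastFwd) λ ()
... | no _ = lastFwd

infix 4 _↝_
data _↝_ : Profile → Profile → Set where
  markLater : ∀ {a u b} → ⟨ a , suc u , b ⟩ ↝ ⟨ a , u , b ⟩
  extendFirst : ∀ {a u b} → ⟨ suc a , u , b ⟩ ↝ ⟨ a , u , b ⟩
  cutLead : ∀ {p q} → 2 + lead q ≤ lead p → p ↝ q

↝-value : ∀ {p q} → p ↝ q → value q ≢ value p
↝-value (markLater {a} {u} {b}) eq =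
  ⊕-not a (parity u xor b) (trans (cong (a ⊕_) (not-distribˡ-xor (parity u) b)) (sym eq))
↝-value (extendFirst {a} {u} {b}) eq = <⇒≢ (n<1+n a) (⊕-injectiveˡ (parity u xor b) eq)
↝-value {p} {q} (cutLead le) eq = <⇒≢ (⌊n/2⌋-mono le)
  (trans (sym (⌊⊕/2⌋ (lead q) (parityBit q))) (trans (cong ⌊_/2⌋ eq) (⌊⊕/2⌋ (lead p) (parityBit p))))

↝-cons : ∀ m {p q u u′} → p ↝ q → suc u′ ≡ u → profileCons m p u ↝ profileCons m q u′
↝-cons none markLater _ = markLater
↝-cons none extendFirst _ = extendFirst
↝-cons none (cutLead le) _ = cutLead (s≤s le)
↝-cons fwd _ refl = markLater
↝-cons bwd _ refl = markLater

markFirst-↝ : ∀ n (X : Decoration (Path (suc n))) c → head X ≡ none →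
              compatible (arrow c) (X (fsuc fzero)) ≡ true → profile (suc n) X ↝ profile (suc n) (play X fzero c)
markFirst-↝ n X c free ok rewrite free | profileCons-arrow c (profile n (tail X)) (unmarkedCount n (tail X))
  with X (fsuc fzero) in eq
... | none = cutLead (s≤s (head-none⇒lead-pos n (tail X) eq))
... | fwd rewrite profile-arrow n (tail X) {false} eq | compatible-arrow {c} {false} ok = extendFirst
... | bwd rewrite profile-arrow n (tail X) {true} eq | compatible-arrow {c} {true} ok = extendFirst

move-↝ : ∀ n {X : Decoration (Path n)} (mv : Move n X) → X (lastEdge n) ≡ fwd →
         profile n X ↝ profile n (after mv)
move-↝ zero (move fzero c free _) lastFwd = contradiction (trans (sym free) lastFwd) λ ()
move-↝ (suc n) {X} (move fzero c free legal) _ = markFirst-↝ n X c free (∧-conicalˡ _ _ legal)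
move-↝ (suc n) {X} (move (fsuc e) c free legal) lastFwd =
  ↝-cons (head X) (move-↝ n (move e c free (∧-conicalʳ _ _ legal)) lastFwd)
                   (unmarkedCount-play n (tail X) c free)

liftPastNone : ∀ {n} {X : Decoration (Path (suc n))} → head X ≡ none → (mv : Move n (tail X)) →
               Σ (Move (suc n) X) λ mv′ → profile (suc n) (after mv′) ≡ extendLead (profile n (after mv))
liftPastNone {n} free mv =
  let mv′ = liftMove mv (compatible-noneˡ (head (after mv)) free)
  in mv′ , profile-none n (after mv′) free

liftPastArrow : ∀ {n} {X : Decoration (Path (suc n))} {c} → head X ≡ arrow c → (mv : Move n (tail X)) →
                compatible (arrow c) (head (after mv)) ≡ true →
                Σ (Move (suc n) X) λ mv′ →
                  profile (suc n) (after mv′) ≡ ⟨ 0 , unmarkedCount n (after mv) , c ⟩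
liftPastArrow {n} marked mv ok =
  let mv′ = liftMove mv (subst (λ m → compatible m (head (after mv)) ≡ true) (sym marked) ok)
  in mv′ , profile-arrow-suc n (after mv′) marked

markFirst : ∀ {n} (X : Decoration (Path (suc n))) c → head X ≡ none →
            compatible (arrow c) (X (fsuc fzero)) ≡ true → pathState n (tail X) ≡ true → Move (suc n) X
markFirst X c free ok state = move fzero c free (cong₂ _∧_ ok state)

cutLead-move : ∀ n (X : Decoration (Path n)) k δ → pathState n X ≡ true → 2 + k ≤ lead (profile n X) →
               Σ (Move n X) λ mv → lead (profile n (after mv)) ≡ k × parityBit (profile n (after mv)) ≡ δ
cutLead-move zero X k δ _ le with X fzero
cutLead-move zero X k δ _ (s≤s ()) | none
cutLead-move zero X k δ _ () | fwd
cutLead-move zero X k δ _ () | bwd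
cutLead-move (suc n) X zero δ state le =
  move fzero c free legal , cong lead profile≡ , trans (cong parityBit profile≡) parityBit≡
  where
  free = lead-pos⇒head-none (suc n) X (≤-trans (s≤s z≤n) le)
  u = unmarkedCount n (tail X)
  c = parity u xor δ
  nextFree : X (fsuc fzero) ≡ none
  nextFree = lead-pos⇒head-none n (tail X) (≤-pred (subst (2 ≤_) (cong lead (profile-none n X free)) le))
  legal : compatible (arrow c) (X (fsuc fzero)) ∧ pathState n (tail X) ≡ true
  legal = cong₂ _∧_ (compatible-noneʳ (arrow c) nextFree) (∧-conicalʳ _ _ state)
  profile≡ : profileCons (arrow c) (profile n (tail X)) u ≡ ⟨ 0 , u , c ⟩
  profile≡ = profileCons-arrow c (profile n (tail X)) u
  parityBit≡ : parity u xor c ≡ δ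
  parityBit≡ = trans (sym (xor-assoc (parity u) (parity u) δ)) (cong (_xor δ) (xor-same (parity u)))
cutLead-move (suc n) X (suc k) δ state le =
  let free = lead-pos⇒head-none (suc n) X (≤-trans (s≤s z≤n) le)
      mv , lead≡ , parityBit≡ = cutLead-move n (tail X) k δ (∧-conicalʳ _ _ state)
                                  (≤-pred (subst (3 + k ≤_) (cong lead (profile-none n X free)) le))
      mv′ , profile≡ = liftPastNone free mv
  in mv′ , trans (cong lead profile≡) (cong suc lead≡) , trans (cong parityBit profile≡) parityBit≡

extendFirst-move : ∀ n (X : Decoration (Path n)) → pathState n X ≡ true → X (lastEdge n) ≡ fwd →
                   1 ≤ lead (profile n X) →
                   Σ (Move n X) λ mv → profile n X ≡ extendLead (profile n (after mv))
extendFirst-move zero X _ lastFwd le = contradiction (trans (sym (lead-pos⇒head-none zero X le)) lastFwd) λ ()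
extendFirst-move (suc n) X state lastFwd le with markView (X (fsuc fzero))
... | inj₁ nextFree =
  let mv , profile≡ = extendFirst-move n (tail X) (∧-conicalʳ _ _ state) lastFwd
                        (head-none⇒lead-pos n (tail X) nextFree)
      mv′ , profile′≡ = liftPastNone free mv
  in mv′ , trans (profile-none n X free) (cong extendLead (trans profile≡ (sym profile′≡)))
  where free = lead-pos⇒head-none (suc n) X le
... | inj₂ (c , nextMarked) =
  markFirst X c free (compatible-refl (sym nextMarked)) (∧-conicalʳ _ _ state) ,
  trans (profile-none n X free)
        (cong extendLead (trans (profile-arrow n (tail X) nextMarked) (sym (profileCons-arrow c _ _))))
  where free = lead-pos⇒head-none (suc n) X le

-- The left neighbour of Y carries the arrow c₀. The unmarked edges of Y can only all be blocked
-- when the arrows change direction across each of them, which would make their number have the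
-- parity of c₀ since the last arrow is fwd.
markBehind-move : ∀ n (Y : Decoration (Path n)) c₀ → pathState n Y ≡ true → Y (lastEdge n) ≡ fwd →
                  compatible (arrow c₀) (head Y) ≡ true → parity (unmarkedCount n Y) xor c₀ ≡ true →
                  Σ (Move n Y) λ mv → compatible (arrow c₀) (head (after mv)) ≡ true
markBehind-move zero Y false _ lastFwd _ odd =
  contradiction (subst (λ m → parity (unmarked m) xor false ≡ true) lastFwd odd) λ ()
markBehind-move zero Y true _ lastFwd ok _ =
  contradiction (subst (λ m → compatible bwd m ≡ true) lastFwd ok) λ ()
markBehind-move (suc n) Y c₀ state lastFwd ok odd with markView (head Y)
... | inj₂ (c , marked) with compatible-arrow {c₀} {c} (subst (λ m → compatible (arrow c₀) m ≡ true) marked ok)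
...   | refl =
  let mv , ok′ = markBehind-move n (tail Y) c₀ (∧-conicalʳ _ _ state) lastFwd
                   (subst (λ m → compatible m (head (tail Y)) ≡ true) marked (∧-conicalˡ _ _ state))
                   (subst (λ k → parity k xor c₀ ≡ true) (unmarkedCount-arrow n Y marked) odd)
      mv′ , _ = liftPastArrow marked mv ok′
  in mv′ , ok
markBehind-move (suc n) Y c₀ state lastFwd ok odd | inj₁ free with markView (Y (fsuc fzero))
... | inj₁ nextFree =
  markFirst Y c₀ free (compatible-noneʳ (arrow c₀) nextFree) (∧-conicalʳ _ _ state) , compatible-refl refl
... | inj₂ (c₁ , nextMarked) with c₁ ≟ᵇ c₀
...   | yes refl =
  markFirst Y c₀ free (compatible-refl (sym nextMarked)) (∧-conicalʳ _ _ state) , compatible-refl refl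
...   | no c₁≢c₀ =
  let mv , _ = markBehind-move n (tail Y) c₁ (∧-conicalʳ _ _ state) lastFwd
                 (compatible-refl (sym nextMarked)) odd′
      mv′ , _ = liftPastNone free mv
  in mv′ , compatible-noneʳ (arrow c₀) free
  where
  t = parity (unmarkedCount n (tail Y))
  odd′ : t xor c₁ ≡ true
  odd′ = begin
    t xor c₁          ≡⟨ cong (t xor_) (¬-not c₁≢c₀) ⟩
    t xor not c₀      ≡⟨ sym (not-distribʳ-xor t c₀) ⟩
    not (t xor c₀)    ≡⟨ not-distribˡ-xor t c₀ ⟩
    not t xor c₀      ≡⟨ subst (λ k → parity k xor c₀ ≡ true) (unmarkedCount-none n Y free) odd ⟩
    true              ∎
    where open ≡-Reasoning

markLater-move : ∀ n (X : Decoration (Path n)) → pathState n X ≡ true → X (lastEdge n) ≡ fwd →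
                 parityBit (profile n X) ≡ true →
                 Σ (Move n X) λ mv → lead (profile n (after mv)) ≡ lead (profile n X)
                                   × parityBit (profile n (after mv)) ≡ false
markLater-move zero X _ lastFwd odd =
  contradiction (subst (λ m → parityBit (profileCons m ⟨ 0 , 0 , false ⟩ 0) ≡ true) lastFwd odd) λ ()
markLater-move (suc n) X state lastFwd odd with markView (head X)
... | inj₁ free =
  let profile≡ = profile-none n X free
      mv , lead≡ , even = markLater-move n (tail X) (∧-conicalʳ _ _ state) lastFwd
                            (subst (λ p → parityBit p ≡ true) profile≡ odd)
      mv′ , profile′≡ = liftPastNone free mv
  in mv′ , trans (cong lead profile′≡) (trans (cong suc lead≡) (sym (cong lead profile≡))) ,
     trans (cong parityBit profile′≡) even
... | inj₂ (c , marked) =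
  let profile≡ = profile-arrow-suc n X marked
      odd′ = subst (λ p → parityBit p ≡ true) profile≡ odd
      mv , ok = markBehind-move n (tail X) c (∧-conicalʳ _ _ state) lastFwd
                  (subst (λ m → compatible m (head (tail X)) ≡ true) marked (∧-conicalˡ _ _ state)) odd′
      mv′ , profile′≡ = liftPastArrow marked mv ok
  in mv′ , trans (cong lead profile′≡) (sym (cong lead profile≡)) ,
     trans (cong parityBit profile′≡)
       (trans (cong (_xor c) (parity-after n mv))
              (trans (sym (not-distribˡ-xor (parity (unmarkedCount n (tail X))) c)) (cong not odd′)))

reachable : ∀ n (X : Decoration (Path n)) → pathState n X ≡ true → X (lastEdge n) ≡ fwd →
            ∀ {w} → w < value (profile n X) → Σ (Move n X) λ mv → value (profile n (after mv)) ≡ w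
reachable n X state lastFwd w< with below (lead (profile n X)) (parityBit (profile n X)) w<
... | cut k δ le refl =
  let mv , lead≡ , parityBit≡ = cutLead-move n X k δ state le
  in mv , cong₂ _⊕_ lead≡ parityBit≡
... | shrink suc≡lead even =
  let mv , profile≡ = extendFirst-move n X state lastFwd (subst (1 ≤_) suc≡lead (s≤s z≤n))
  in mv , cong₂ _⊕_ (suc-injective (trans (sym (cong lead profile≡)) (sym suc≡lead)))
                    (trans (sym (cong parityBit profile≡)) even)
... | turn refl odd =
  let mv , lead≡ , even = markLater-move n X state lastFwd odd
  in mv , cong₂ _⊕_ lead≡ even

follower⇒move : ∀ n (X : Decoration (Path n)) {Y} → Y ∈ followers (Path n) X →
                Σ (Move n X) λ mv → after mv ≡ Y
follower⇒move n X Y∈ with ∈-followers⁻ (Path n) X Y∈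
... | e , c , free , refl , stateY = move e c free (trans (sym (isState-Path n _)) stateY) , refl

move⇒follower : ∀ n {X : Decoration (Path n)} (mv : Move n X) → after mv ∈ followers (Path n) X
move⇒follower n {X} (move e c free legal) = ∈-followers⁺ (Path n) X e c free (trans (isState-Path n _) legal)

grundyFuel-value : ∀ k n (X : Decoration (Path n)) → pathState n X ≡ true → X (lastEdge n) ≡ fwd →
                   unmarkedCount n X ≤ k → grundyFuel (Path n) k X ≡ value (profile n X)
grundyFuel-value zero n X state lastFwd count≤0 with 0 <? value (profile n X)
... | no ≮ = sym (n≤0⇒n≡0 (≮⇒≥ ≮))
... | yes 0< = let mv , _ = reachable n X state lastFwd 0<
               in contradiction (subst (_≤ 0) (sym (unmarkedCount-after n mv)) count≤0) λ ()
grundyFuel-value (suc k) n X state lastFwd count≤ = mex≡ (map g (followers (Path n) X)) reached missed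
  where
  g = grundyFuel (Path n) k
  g-after : (mv : Move n X) → g (after mv) ≡ value (profile n (after mv))
  g-after mv = grundyFuel-value k n (after mv) (Move.legal mv) (lastEdge-after n mv lastFwd)
                 (≤-pred (subst (_≤ suc k) (sym (unmarkedCount-after n mv)) count≤))
  reached : ∀ {w} → w < value (profile n X) → w ∈ map g (followers (Path n) X)
  reached w< = let mv , value≡ = reachable n X state lastFwd w<
               in subst (_∈ map g (followers (Path n) X)) (trans (g-after mv) value≡)
                        (∈-map⁺ g (move⇒follower n mv))
  missed : value (profile n X) ∉ map g (followers (Path n) X)
  missed v∈ with ∈-map⁻ g v∈
  ... | Y , Y∈ , v≡ with follower⇒move n X Y∈
  ...   | mv , refl = ↝-value (move-↝ n mv lastFwd) (sym (trans v≡ (g-after mv)))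

profile-T : ∀ n → profile n (T n) ≡ ⟨ n , 0 , false ⟩
profile-T zero = refl
profile-T (suc n) = cong extendLead (profile-T n)

unmarkedCount-T : ∀ n → unmarkedCount n (T n) ≡ n
unmarkedCount-T zero = refl
unmarkedCount-T (suc n) = cong suc (unmarkedCount-T n)

pathState-T : ∀ n → pathState n (T n) ≡ true
pathState-T zero = refl
pathState-T (suc n) = pathState-T n

T-lastEdge : ∀ n → T n (lastEdge n) ≡ fwd
T-lastEdge n with lastEdge n ≟F lastEdge n
... | yes _ = refl
... | no ≢ = contradiction refl ≢

mainTheorem9 : (n : ℕ) → grundy (Path n) (T n) ≡ n
mainTheorem9 n = begin
  grundyFuel (Path n) (suc n) (T n)
    ≡⟨ grundyFuel-value (suc n) n (T n) (pathState-T n) (T-lastEdge n)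
                        (subst (_≤ suc n) (sym (unmarkedCount-T n)) (n≤1+n n)) ⟩
  value (profile n (T n))
    ≡⟨ cong value (profile-T n) ⟩
  n ∎
  where open ≡-Reasoning
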